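{- The set $S'=\{PQ-QP\colon P \text{ and } Q \text{ prime words}\}$ generates the two-sided ideal $\mathcal{J}$.
   Context: Let $\mathcal{A}$ be the free associative $\mathbb{C}$-algebra on two generators $L$ and $R$ (letters). A word is a finite product of letters (possibly empty). A word is balanced if $L$ and $R$ occur in it equally many times. Let $S=\{FG-GF\colon F,G \text{ nonempty balanced words}\}$ and let $\mathcal{J}$ be the two-sided ideal of $\mathcal{A}$ generated by $S$. A word is prime if it is nonempty, balanced, and cannot be written as the product of two nonempty balanced words. -}

module Defs where

open import Level using (Level; _⊔_)
open import Algebra.Bundles using (CommutativeRing)
open import Data.List using (List; []; _∷_; _++_; concatMap)
open import Data.List.Relation.Unary.All using (All)
open import Data.Nat using (ℕ; zero; suc)
open import Data.Product using (Σ; _×_; _,_; ∃-syntax)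
open import Relation.Binary.PropositionalEquality using (_≡_; _≢_; refl)
open import Relation.Nullary using (¬_; yes; no; Dec)
open import Relation.Binary.Definitions using (DecidableEquality)
import Data.List.Properties as LP

data Letter : Set where
  L R : Letter

_≟L_ : DecidableEquality Letter
L ≟L L = yes refl
L ≟L R = no (λ ())
R ≟L L = no (λ ())
R ≟L R = yes refl

Word : Set
Word = List Letter

_≟W_ : DecidableEquality Word
_≟W_ = LP.≡-dec _≟L_

count : Letter → Word → ℕ
count a [] = zero
count a (b ∷ w) with a ≟L b
... | yes _ = suc (count a w)
... | no _  = count a w

Nonempty : Word → Set
Nonempty w = w ≢ []

Balanced : Word → Set
Balanced w = count L w ≡ count R w

NonemptyBalanced : Word → Set
NonemptyBalanced w = Nonempty w × Balanced w

Prime : Word → Set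
Prime w = NonemptyBalanced w ×
  ¬ (Σ Word λ u → Σ Word λ v →
       NonemptyBalanced u × NonemptyBalanced v × w ≡ u ++ v)

-- The free associative algebra over a commutative ring K on {L, R}:
-- elements are finite formal linear combinations of words, compared
-- coefficientwise.

module FreeAlgebra {c ℓ : Level} (K : CommutativeRing c ℓ) where
  open CommutativeRing K renaming (Carrier to 𝕂)

  Poly : Set c
  Poly = List (𝕂 × Word)

  coeff : Word → Poly → 𝕂
  coeff w [] = 0#
  coeff w ((k , u) ∷ p) with w ≟W u
  ... | yes _ = k + coeff w p
  ... | no _  = coeff w p

  _≈ₚ_ : Poly → Poly → Set ℓ
  p ≈ₚ q = ∀ w → coeff w p ≈ coeff w q

  sandwich : 𝕂 → Word → Poly → Word → Poly
  sandwich k u [] v = []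
  sandwich k u ((d , w) ∷ g) v = (k * d , u ++ w ++ v) ∷ sandwich k u g v

  comm : Word → Word → Poly
  comm F G = (1# , F ++ G) ∷ (- 1# , G ++ F) ∷ []

  InIdeal : (Poly → Set c) → Poly → Set (c ⊔ ℓ)
  InIdeal Gen x =
    Σ (List (𝕂 × Word × Poly × Word)) λ ts →
      All (λ { (k , u , g , v) → Gen g }) ts ×
      x ≈ₚ concatMap (λ { (k , u , g , v) → sandwich k u g v }) ts

  S : Poly → Set c
  S p = Σ Word λ F → Σ Word λ G →
          NonemptyBalanced F × NonemptyBalanced G × p ≡ comm F G

  S′ : Poly → Set c
  S′ p = Σ Word λ P → Σ Word λ Q → Prime P × Prime Q × p ≡ comm P Q

-- Write F = uv when a nonempty balanced word F is not prime.  Then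
--   FG − GF = u(vG − Gv) + (uG − Gu)v,
-- and the same holds inside any two-sided context x (−) y, so by induction on
-- |F| + |G| every x(FG − GF)y is a sum of terms x′(PQ − QP)y′ with P, Q prime.
-- Conversely prime words are nonempty and balanced, so S′ ⊆ S.
module Submission where

open import Defs
open import Level using (Level; _⊔_)
open import Algebra.Bundles using (CommutativeRing)
open import Data.Nat using (_<_; s≤s; z≤n)
import Data.Nat as ℕ
open import Data.Nat.Properties using (m<m+n; m<n+m; +-monoˡ-<; +-monoʳ-<)
open import Data.Nat.Induction using (<-wellFounded)
open import Induction.WellFounded using (Acc; acc)
open import Data.Product using (Σ; _×_; _,_; proj₁)
open import Data.Empty using (⊥-elim)
open import Data.Sum using (_⊎_; inj₁; inj₂)
open import Data.List using (List; []; _∷_; _++_; concatMap; length)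
open import Data.List.Properties using (++-assoc; ++-identityʳ; length-++; concatMap-++; ++-monoid)
open import Tactic.MonoidSolver using (solve)
open import Data.List.Relation.Unary.All using (All; []; _∷_)
open import Data.List.Relation.Unary.All.Properties using (++⁺)
open import Relation.Binary.PropositionalEquality as ≡ using (_≡_; refl; cong; subst₂)
open import Relation.Nullary using (Dec; yes; no; ¬?; _×-dec_)
import Algebra.Properties.Ring as RingProperties

Splits : (Word → Word → Set) → Word → Set
Splits Q w = Σ Word λ u → Σ Word λ v → Q u v × w ≡ u ++ v

splits? : (Q : Word → Word → Set) → (∀ u v → Dec (Q u v)) → ∀ w → Dec (Splits Q w)
splits? Q Q? [] with Q? [] []
... | yes q = yes ([] , [] , q , refl)
... | no ¬q = no λ { ([] , [] , q , refl) → ¬q q }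
splits? Q Q? (a ∷ w) with Q? [] (a ∷ w) | splits? (λ u → Q (a ∷ u)) (λ u → Q? (a ∷ u)) w
... | yes q | _ = yes ([] , a ∷ w , q , refl)
... | no _  | yes (u , v , q , eq) = yes (a ∷ u , v , q , cong (a ∷_) eq)
... | no ¬q | no ¬s = no λ { ([] , v , q , refl) → ¬q q
                           ; (_ ∷ u , v , q , refl) → ¬s (u , v , q , refl) }

nonemptyBalanced? : ∀ w → Dec (NonemptyBalanced w)
nonemptyBalanced? w = ¬? (w ≟W []) ×-dec (count L w ℕ.≟ count R w)

BalancedSplit : Word → Word → Set
BalancedSplit u v = NonemptyBalanced u × NonemptyBalanced v

prime-or-balancedSplit : ∀ {w} → NonemptyBalanced w → Prime w ⊎ Splits BalancedSplit w
prime-or-balancedSplit {w} nb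
  with splits? BalancedSplit (λ u v → nonemptyBalanced? u ×-dec nonemptyBalanced? v) w
... | yes s = inj₂ s
... | no ¬s = inj₁ (nb , λ { (u , v , nu , nv , eq) → ¬s (u , v , (nu , nv) , eq) })

length-++-<ʳ : ∀ u v → Nonempty u → length v < length (u ++ v)
length-++-<ʳ []      v ne = ⊥-elim (ne refl)
length-++-<ʳ (a ∷ u) v _  rewrite length-++ (a ∷ u) {v} = m<n+m (length v) (s≤s z≤n)

length-++-<ˡ : ∀ u v → Nonempty v → length u < length (u ++ v)
length-++-<ˡ u []      ne = ⊥-elim (ne refl)
length-++-<ˡ u (b ∷ v) _  rewrite length-++ u {b ∷ v} = m<m+n (length u) (s≤s z≤n)

module _ {c ℓ : Level} (K : CommutativeRing c ℓ) where
  open CommutativeRing K renaming (Carrier to 𝕂; refl to ≈-refl)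
  open FreeAlgebra K
  open RingProperties ring using (-0#≈0#; -‿distribʳ-*)
  open import Relation.Binary.Reasoning.Setoid setoid

  evalTerms : List (𝕂 × Word × Poly × Word) → Poly
  evalTerms = concatMap λ { (k , u , g , v) → sandwich k u g v }

  coeff-++ : ∀ w p q → coeff w (p ++ q) ≈ coeff w p + coeff w q
  coeff-++ w []            q = sym (+-identityˡ _)
  coeff-++ w ((k , u) ∷ p) q with w ≟W u
  ... | yes _ = trans (+-congˡ (coeff-++ w p q)) (sym (+-assoc _ _ _))
  ... | no _  = coeff-++ w p q

  ++-cong : ∀ {p p′ q q′} → p ≈ₚ p′ → q ≈ₚ q′ → (p ++ q) ≈ₚ (p′ ++ q′)
  ++-cong {p} {p′} {q} {q′} p≈p′ q≈q′ w = begin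
    coeff w (p ++ q)            ≈⟨ coeff-++ w p q ⟩
    coeff w p + coeff w q       ≈⟨ +-cong (p≈p′ w) (q≈q′ w) ⟩
    coeff w p′ + coeff w q′     ≈⟨ coeff-++ w p′ q′ ⟨
    coeff w (p′ ++ q′)          ∎

  ∷-cong : ∀ {k k′} a {p q} → k ≈ k′ → p ≈ₚ q → ((k , a) ∷ p) ≈ₚ ((k′ , a) ∷ q)
  ∷-cong a k≈k′ p≈q w with w ≟W a
  ... | yes _ = +-cong k≈k′ (p≈q w)
  ... | no _  = p≈q w

  coeff-negate : ∀ w k a → coeff w ((- k , a) ∷ []) ≈ - coeff w ((k , a) ∷ [])
  coeff-negate w k a with w ≟W a
  ... | yes _ = trans (+-identityʳ _) (-‿cong (sym (+-identityʳ k)))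
  ... | no _  = sym -0#≈0#

  InIdeal-resp : ∀ {Gen p q} → p ≈ₚ q → InIdeal Gen q → InIdeal Gen p
  InIdeal-resp p≈q (ts , gens , q≈ts) = ts , gens , λ w → trans (p≈q w) (q≈ts w)

  InIdeal-++ : ∀ {Gen p q} → InIdeal Gen p → InIdeal Gen q → InIdeal Gen (p ++ q)
  InIdeal-++ {p = p} {q} (ts , gs , p≈ts) (ss , hs , q≈ss) = ts ++ ss , ++⁺ gs hs , λ w → begin
    coeff w (p ++ q)                            ≈⟨ ++-cong {p} {evalTerms ts} {q} p≈ts q≈ss w ⟩
    coeff w (evalTerms ts ++ evalTerms ss)      ≡⟨ cong (coeff w) (concatMap-++ _ ts ss) ⟨
    coeff w (evalTerms (ts ++ ss))              ∎

  InIdeal-generator : ∀ {Gen g} k u v → Gen g → InIdeal Gen (sandwich k u g v)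
  InIdeal-generator {g = g} k u v gen =
    (k , u , g , v) ∷ [] , gen ∷ [] ,
    λ w → reflexive (cong (coeff w) (≡.sym (++-identityʳ (sandwich k u g v))))

  InIdeal-⊆ : ∀ {Gen Gen′} → (∀ {g} k u v → Gen g → InIdeal Gen′ (sandwich k u g v)) →
                 ∀ {p} → InIdeal Gen p → InIdeal Gen′ p
  InIdeal-⊆ {Gen} {Gen′} sandwich∈ {p} (ts , gens , p≈ts) =
    InIdeal-resp {p = p} {evalTerms ts} p≈ts (evalTerms∈ ts gens)
    where
    evalTerms∈ : ∀ ts → All (λ { (k , u , g , v) → Gen g }) ts → InIdeal Gen′ (evalTerms ts)
    evalTerms∈ []                  []           = [] , [] , λ w → ≈-refl
    evalTerms∈ ((k , u , g , v) ∷ ts) (gen ∷ gens) =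
      InIdeal-++ {p = sandwich k u g v} (sandwich∈ k u v gen) (evalTerms∈ ts gens)

  scaledDiff : 𝕂 → Word → Word → Poly
  scaledDiff k a b = (k , a) ∷ (- k , b) ∷ []

  coeff-scaledDiff : ∀ w k a b →
                     coeff w (scaledDiff k a b) ≈ coeff w ((k , a) ∷ []) - coeff w ((k , b) ∷ [])
  coeff-scaledDiff w k a b =
    trans (coeff-++ w ((k , a) ∷ []) ((- k , b) ∷ [])) (+-congˡ (coeff-negate w k b))

  x-y+y-z≈x-z : ∀ x y z → (x - y) + (y - z) ≈ x - z
  x-y+y-z≈x-z x y z = begin
    (x - y) + (y - z)    ≈⟨ +-assoc x (- y) (y - z) ⟩
    x + (- y + (y - z))  ≈⟨ +-congˡ (+-assoc (- y) y (- z)) ⟨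
    x + ((- y + y) - z)  ≈⟨ +-congˡ (+-congʳ (-‿inverseˡ y)) ⟩
    x + (0# - z)         ≈⟨ +-congˡ (+-identityˡ (- z)) ⟩
    x - z                ∎

  scaledDiff-telescope : ∀ k a b d → scaledDiff k a d ≈ₚ (scaledDiff k a b ++ scaledDiff k b d)
  scaledDiff-telescope k a b d w = begin
    coeff w (scaledDiff k a d)                                  ≈⟨ coeff-scaledDiff w k a d ⟩
    cₖ a - cₖ d                                                 ≈⟨ x-y+y-z≈x-z (cₖ a) (cₖ b) (cₖ d) ⟨
    (cₖ a - cₖ b) + (cₖ b - cₖ d)                               ≈⟨ +-cong (coeff-scaledDiff w k a b)
                                                                          (coeff-scaledDiff w k b d) ⟨
    coeff w (scaledDiff k a b) + coeff w (scaledDiff k b d)     ≈⟨ coeff-++ w (scaledDiff k a b) _ ⟨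
    coeff w (scaledDiff k a b ++ scaledDiff k b d)              ∎
    where
    cₖ : Word → 𝕂
    cₖ a = coeff w ((k , a) ∷ [])

  -- a ≡ b modulo the ideal; asking it for every multiple k(a − b) spares us proving
  -- that ideals are closed under scalars.
  Congruent : (Poly → Set c) → Word → Word → Set (c ⊔ ℓ)
  Congruent Gen a b = ∀ k → InIdeal Gen (scaledDiff k a b)

  Congruent-trans : ∀ {Gen a b d} → Congruent Gen a b → Congruent Gen b d → Congruent Gen a d
  Congruent-trans {a = a} {b} {d} a≡b b≡d k =
    InIdeal-resp {p = scaledDiff k a d} {scaledDiff k a b ++ scaledDiff k b d}
      (scaledDiff-telescope k a b d) (InIdeal-++ {p = scaledDiff k a b} (a≡b k) (b≡d k))

  CommuteModulo : (Poly → Set c) → Word → Word → Set (c ⊔ ℓ)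
  CommuteModulo Gen F G = ∀ x y → Congruent Gen (x ++ F ++ G ++ y) (x ++ G ++ F ++ y)

  CommuteModulo-++ˡ : ∀ {Gen u v G} →
    CommuteModulo Gen u G → CommuteModulo Gen v G → CommuteModulo Gen (u ++ v) G
  CommuteModulo-++ˡ {Gen} {u} {v} {G} uG vG x y =
    Congruent-trans (subst₂ (Congruent Gen) xuvGy refl (vG (x ++ u) y))
                    (subst₂ (Congruent Gen) xuGvy xGuvy (uG x (v ++ y)))
    where
    xuvGy : (x ++ u) ++ v ++ G ++ y ≡ x ++ (u ++ v) ++ G ++ y
    xuvGy = solve (++-monoid Letter)
    xuGvy : x ++ u ++ G ++ v ++ y ≡ (x ++ u) ++ G ++ v ++ y
    xuGvy = solve (++-monoid Letter)
    xGuvy : x ++ G ++ u ++ v ++ y ≡ x ++ G ++ (u ++ v) ++ y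
    xGuvy = solve (++-monoid Letter)

  CommuteModulo-++ʳ : ∀ {Gen F u v} →
    CommuteModulo Gen F u → CommuteModulo Gen F v → CommuteModulo Gen F (u ++ v)
  CommuteModulo-++ʳ {Gen} {F} {u} {v} Fu Fv x y =
    Congruent-trans (subst₂ (Congruent Gen) xFuvy refl (Fu x (v ++ y)))
                    (subst₂ (Congruent Gen) xuFvy xuvFy (Fv (x ++ u) y))
    where
    xFuvy : x ++ F ++ u ++ v ++ y ≡ x ++ F ++ (u ++ v) ++ y
    xFuvy = solve (++-monoid Letter)
    xuFvy : (x ++ u) ++ F ++ v ++ y ≡ x ++ u ++ F ++ v ++ y
    xuFvy = solve (++-monoid Letter)
    xuvFy : (x ++ u) ++ v ++ F ++ y ≡ x ++ (u ++ v) ++ F ++ y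
    xuvFy = solve (++-monoid Letter)

  sandwich-comm : ∀ k x F G y →
    sandwich k x (comm F G) y ≈ₚ scaledDiff k (x ++ F ++ G ++ y) (x ++ G ++ F ++ y)
  sandwich-comm k x F G y rewrite ++-assoc F G y | ++-assoc G F y =
    ∷-cong _ (*-identityʳ k) (∷-cong _ k*-1≈-k λ w → ≈-refl)
    where
    k*-1≈-k : k * - 1# ≈ - k
    k*-1≈-k = trans (sym (-‿distribʳ-* k 1#)) (-‿cong (*-identityʳ k))

  primes-commuteModulo-S′ : ∀ {P Q} → Prime P → Prime Q → CommuteModulo S′ P Q
  primes-commuteModulo-S′ {P} {Q} pP pQ x y k =
    InIdeal-resp {p = scaledDiff k _ _} {sandwich k x (comm P Q) y}
      (λ w → sym (sandwich-comm k x P Q y w))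
      (InIdeal-generator k x y (P , Q , pP , pQ , refl))

  nonemptyBalanced-commuteModulo-S′ : ∀ {F G} →
    NonemptyBalanced F → NonemptyBalanced G → CommuteModulo S′ F G
  nonemptyBalanced-commuteModulo-S′ nF nG = go nF nG (<-wellFounded _)
    where
    go : ∀ {F G} → NonemptyBalanced F → NonemptyBalanced G →
         Acc _<_ (length F ℕ.+ length G) → CommuteModulo S′ F G
    go {F} {G} nF nG (acc rec) with prime-or-balancedSplit nF | prime-or-balancedSplit nG
    ... | inj₂ (u , v , (nu , nv) , refl) | _ = CommuteModulo-++ˡ {u = u} {v} {G}
      (go nu nG (rec (+-monoˡ-< (length G) (length-++-<ˡ u v (proj₁ nv)))))
      (go nv nG (rec (+-monoˡ-< (length G) (length-++-<ʳ u v (proj₁ nu)))))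
    ... | inj₁ _ | inj₂ (u , v , (nu , nv) , refl) = CommuteModulo-++ʳ {F = F} {u} {v}
      (go nF nu (rec (+-monoʳ-< (length F) (length-++-<ˡ u v (proj₁ nv)))))
      (go nF nv (rec (+-monoʳ-< (length F) (length-++-<ʳ u v (proj₁ nu)))))
    ... | inj₁ pF | inj₁ pG = primes-commuteModulo-S′ pF pG

  sandwich-S∈ideal-S′ : ∀ {g} k u v → S g → InIdeal S′ (sandwich k u g v)
  sandwich-S∈ideal-S′ k u v (F , G , nF , nG , refl) =
    InIdeal-resp {p = sandwich k u (comm F G) v} {scaledDiff k _ _} (sandwich-comm k u F G v)
      (nonemptyBalanced-commuteModulo-S′ nF nG u v k)

  sandwich-S′∈ideal-S : ∀ {g} k u v → S′ g → InIdeal S (sandwich k u g v)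
  sandwich-S′∈ideal-S k u v (P , Q , (nP , _) , (nQ , _) , g≡PQ-QP) =
    InIdeal-generator k u v (P , Q , nP , nQ , g≡PQ-QP)

lemma4p3 : {c ℓ : Level} (K : CommutativeRing c ℓ) →
    let open FreeAlgebra K in
    (x : Poly) → (InIdeal S x → InIdeal S′ x) × (InIdeal S′ x → InIdeal S x)
lemma4p3 K x = InIdeal-⊆ K (sandwich-S∈ideal-S′ K) {x}
             , InIdeal-⊆ K (sandwich-S′∈ideal-S K) {x}
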